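{- Let $k<\ell$ be positive integers. If $(\mathbf{m},\mathbf{n})\in\widetilde{\mathcal{D}}(k,\ell)$, then $\iota(\mathbf{n})\le\iota_{\max}(k,\ell)$.
   Context: $\mathbb{N}=\{1,2,\dots\}$, $\mathbb{N}_0=\mathbb{N}\cup\{0\}$. For a tuple $\mathbf{x}$, $\iota(\mathbf{x})$ is the number of entries equal to $1$. For $k<\ell$ with $\psi=\lceil\ell/k\rceil$, $\iota_{\max}(k,\ell)=\max\left\{(\psi-1)k,\ \frac{\psi}{\psi-1}(\ell-k)\right\}$. For $\mathbf{r}\in\mathbb{N}_0^r$, $\mathbf{s}\in\mathbb{N}_0^s$, $\mathcal{A}(\mathbf{r},\mathbf{s})$ is the set of $r\times s$ $\{0,1\}$-matrices with row-sum vector $\mathbf{r}$ and column-sum vector $\mathbf{s}$. $\widetilde{\mathcal{D}}(k,\ell)$ is the set of pairs $(\mathbf{m},\mathbf{n})\in\mathbb{N}^k\times\mathbb{N}^\ell$ for which there exist $s\in\mathbb{N}$, $\mathbf{r}\in\mathbb{N}_0^s$, $V\in\mathcal{A}(\mathbf{r},\mathbf{m})$ and $W\in\mathcal{A}(\mathbf{r},\mathbf{n})$ such that every entry of $V^\top W$ is a positive integer. -}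

module Defs where

open import Data.Nat as ℕ using (ℕ; zero; suc; _+_; _*_; _∸_; _≤_; _<_; NonZero)
open import Data.Fin using (Fin; zero; suc)
open import Data.Integer as ℤ using (ℤ; +_)
open import Data.Rational as ℚ using (ℚ; _/_; _⊔_; ceiling)
open import Data.Product using (Σ; _×_; _,_)
open import Relation.Binary.PropositionalEquality using (_≡_)
open import Data.Sum using (_⊎_)
open import Relation.Nullary using (Dec; yes; no)

sumFin : ∀ {n} → (Fin n → ℕ) → ℕ
sumFin {zero}  f = 0
sumFin {suc n} f = f zero + sumFin (λ i → f (suc i))

ι : ∀ {n} → (Fin n → ℕ) → ℕ
ι {zero}  x = 0
ι {suc n} x with x zero ℕ.≟ 1
... | yes _ = suc (ι (λ i → x (suc i)))
... | no  _ = ι (λ i → x (suc i))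

ψ : (k ℓ : ℕ) → .{{_ : NonZero k}} → ℕ
ψ k ℓ = ℤ.∣ ceiling ((+ ℓ) / k) ∣

-- ι_max(k,ℓ) = max{ (ψ-1)k , ψ/(ψ-1) (ℓ-k) }.
-- For k < ℓ we have ψ ≥ 2, so ψ - 1 = suc (ψ ∸ 2); this form is used for
-- the denominator so that it is syntactically nonzero.
ιmax : (k ℓ : ℕ) → .{{_ : NonZero k}} → ℚ
ιmax k ℓ = ((+ ((ψ k ℓ ∸ 1) * k)) / 1) ⊔ ((+ (ψ k ℓ * (ℓ ∸ k))) / suc (ψ k ℓ ∸ 2))

Matrix : ℕ → ℕ → Set
Matrix r c = Fin r → Fin c → ℕ

record In𝒜 {r c : ℕ} (rs : Fin r → ℕ) (cs : Fin c → ℕ) (V : Matrix r c) : Set where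
  field
    binary  : ∀ i j → (V i j ≡ 0) ⊎ (V i j ≡ 1)
    rowSums : ∀ i → sumFin (λ j → V i j) ≡ rs i
    colSums : ∀ j → sumFin (λ i → V i j) ≡ cs j

_ᵀ·_ : ∀ {s k ℓ} → Matrix s k → Matrix s ℓ → Matrix k ℓ
(V ᵀ· W) a b = sumFin (λ i → V i a * W i b)

-- positive tuples (entries in ℕ = {1,2,…})
Positive : ∀ {n} → (Fin n → ℕ) → Set
Positive x = ∀ i → 1 ≤ x i

record In𝒟̃ (k ℓ : ℕ) (m : Fin k → ℕ) (n : Fin ℓ → ℕ) : Set where
  field
    m-pos : Positive m
    n-pos : Positive n
    s     : ℕ
    s-pos : 1 ≤ s
    r     : Fin s → ℕ
    V     : Matrix s k
    W     : Matrix s ℓ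
    V∈𝒜   : In𝒜 r m V
    W∈𝒜   : In𝒜 r n W
    prod-pos : ∀ a b → 1 ≤ (V ᵀ· W) a b

module Submission where

-- Call a row of V full when all its entries are 1, and let t be the number of full rows.
-- If n_b = 1, column b of W has a single 1, in row j say; since (VᵀW)_{ab} ≥ 1 for every a,
-- V_{ja} = 1 for all a, so row j is full. Let c_b count the full rows i with W_{ib} = 1: then
-- c_b ≤ t, c_b = 1 whenever n_b = 1, and Σ_b c_b = t k because full rows have sum k. Hence
-- ι ≤ t k and t k ≤ ι + (ℓ - ι) t. If ι > (ψ-1) k this forces t ≥ ψ, and ι (t-1) ≤ (ℓ-k) t gives
-- ι ≤ t/(t-1) (ℓ-k) ≤ ψ/(ψ-1) (ℓ-k).

open import Defs
open import Data.Fin using (Fin; zero; suc)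
open import Data.Fin.Properties using (all?)
open import Data.Integer as ℤ using (+_; -[1+_]; -≤+)
open import Data.Integer.DivMod using ([n/d]*d≤n)
open import Data.Integer.GCD using (gcd)
import Data.Integer.Properties as ℤ
open import Data.List using (_∷_; [])
open import Data.Nat using (ℕ; zero; suc; NonZero; _+_; _*_; _∸_; _≤_; _<_; z≤n; s≤s; _≟_; _≤?_)
open import Data.Nat.Properties
open import Algebra.Properties.CommutativeSemigroup +-commutativeSemigroup using (x∙yz≈y∙xz)
open import Algebra.Properties.Semiring.Sum +-*-semiring using (sum; sum-cong-≗; ∑-comm; *-distribˡ-sum; *-distribʳ-sum)
open import Data.Nat.Tactic.RingSolver using (solve)
import Data.Rational as ℚ
open import Data.Rational using (_⊔_; ↥_; ↧_; floor; ceiling)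
import Data.Rational.Properties as ℚ
open import Data.Rational.Unnormalised using (mkℚᵘ; *≤*)
import Data.Rational.Unnormalised.Properties as ℚᵘ
open import Data.Empty using (⊥-elim)
open import Data.Sum using (_⊎_; inj₁; inj₂)
open import Function using (_∘_)
open import Relation.Binary.PropositionalEquality
open import Relation.Nullary using (yes; no; contradiction)
open import Relation.Unary using (Decidable)

sumFin≡sum : ∀ {n} (f : Fin n → ℕ) → sumFin f ≡ sum f
sumFin≡sum {zero}  f = refl
sumFin≡sum {suc n} f = cong (λ s → f zero + s) (sumFin≡sum (f ∘ suc))

sumFin-mono : ∀ {n} {f g : Fin n → ℕ} → (∀ i → f i ≤ g i) → sumFin f ≤ sumFin g
sumFin-mono {zero}  f≤g = z≤n
sumFin-mono {suc n} f≤g = +-mono-≤ (f≤g zero) (sumFin-mono (f≤g ∘ suc))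

sumFin-cong : ∀ {n} {f g : Fin n → ℕ} → (∀ i → f i ≡ g i) → sumFin f ≡ sumFin g
sumFin-cong {zero}  f≗g = refl
sumFin-cong {suc n} f≗g = cong₂ _+_ (f≗g zero) (sumFin-cong (f≗g ∘ suc))

sumFin-ones : ∀ n → sumFin {n} (λ _ → 1) ≡ n
sumFin-ones zero    = refl
sumFin-ones (suc n) = cong suc (sumFin-ones n)

sumFin-≥⇒≗ : ∀ {n} {f g : Fin n → ℕ} → (∀ i → f i ≤ g i) → sumFin g ≤ sumFin f → ∀ i → f i ≡ g i
sumFin-≥⇒≗ {suc n} {f} {g} f≤g Σg≤Σf = λ
  { zero    → ≤-antisym (f≤g zero) g₀≤f₀
  ; (suc i) → sumFin-≥⇒≗ (f≤g ∘ suc) G≤F i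
  }
  where
  F = sumFin (f ∘ suc)
  G = sumFin (g ∘ suc)
  g₀≤f₀ : g zero ≤ f zero
  g₀≤f₀ = +-cancelʳ-≤ G _ _ (≤-trans Σg≤Σf (+-monoʳ-≤ (f zero) (sumFin-mono (f≤g ∘ suc))))
  G≤F : G ≤ F
  G≤F = +-cancelˡ-≤ (g zero) _ _ (≤-trans Σg≤Σf (+-monoˡ-≤ F (f≤g zero)))

ι≤sumFin : ∀ {ℓ} (n f : Fin ℓ → ℕ) → (∀ b → n b ≡ 1 → f b ≡ 1) → ι n ≤ sumFin f
ι≤sumFin {zero}  n f unit⇒1 = z≤n
ι≤sumFin {suc ℓ} n f unit⇒1 with n zero ≟ 1
... | yes n₀≡1 rewrite unit⇒1 zero n₀≡1 = s≤s (ι≤sumFin (n ∘ suc) (f ∘ suc) (unit⇒1 ∘ suc))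
... | no  _    = ≤-trans (ι≤sumFin (n ∘ suc) (f ∘ suc) (unit⇒1 ∘ suc)) (m≤n+m _ (f zero))

sumFin+ι*t≤ι+ℓ*t : ∀ {ℓ} (n f : Fin ℓ → ℕ) t → (∀ b → n b ≡ 1 → f b ≡ 1) → (∀ b → f b ≤ t) →
                   sumFin f + ι n * t ≤ ι n + ℓ * t
sumFin+ι*t≤ι+ℓ*t {zero}  n f t unit⇒1 f≤t = z≤n
sumFin+ι*t≤ι+ℓ*t {suc ℓ} n f t unit⇒1 f≤t with n zero ≟ 1
... | yes n₀≡1 rewrite unit⇒1 zero n₀≡1 = s≤s (begin
  F + (t + u * t)   ≡⟨ x∙yz≈y∙xz F t (u * t) ⟩
  t + (F + u * t)   ≤⟨ +-monoʳ-≤ t ih ⟩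
  t + (u + ℓ * t)   ≡⟨ x∙yz≈y∙xz t u (ℓ * t) ⟩
  u + (t + ℓ * t)   ∎)
  where
  open ≤-Reasoning
  F = sumFin (f ∘ suc)
  u = ι (n ∘ suc)
  ih = sumFin+ι*t≤ι+ℓ*t (n ∘ suc) (f ∘ suc) t (unit⇒1 ∘ suc) (f≤t ∘ suc)
... | no _ = begin
  f zero + F + u * t   ≡⟨ +-assoc (f zero) F (u * t) ⟩
  f zero + (F + u * t) ≤⟨ +-mono-≤ (f≤t zero) ih ⟩
  t + (u + ℓ * t)      ≡⟨ x∙yz≈y∙xz t u (ℓ * t) ⟩
  u + (t + ℓ * t)      ∎
  where
  open ≤-Reasoning
  F = sumFin (f ∘ suc)
  u = ι (n ∘ suc)
  ih = sumFin+ι*t≤ι+ℓ*t (n ∘ suc) (f ∘ suc) t (unit⇒1 ∘ suc) (f≤t ∘ suc)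

binary⇒≤1 : ∀ {x} → (x ≡ 0) ⊎ (x ≡ 1) → x ≤ 1
binary⇒≤1 (inj₁ refl) = z≤n
binary⇒≤1 (inj₂ refl) = ≤-refl

module FullRows {k ℓ} {m : Fin k → ℕ} {n : Fin ℓ → ℕ} (D : In𝒟̃ k ℓ m n) where
  open In𝒟̃ D
  open In𝒜

  Full : Fin s → Set
  Full i = ∀ a → V i a ≡ 1

  full? : Decidable Full
  full? i = all? (λ a → V i a ≟ 1)

  [full] : Fin s → ℕ
  [full] i with full? i
  ... | yes _ = 1
  ... | no  _ = 0

  t : ℕ
  t = sumFin [full]

  fullOnes : Fin ℓ → ℕ
  fullOnes b = sumFin (λ i → [full] i * W i b)

  [full]*r≡[full]*k : ∀ i → [full] i * r i ≡ [full] i * k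
  [full]*r≡[full]*k i with full? i
  ... | yes full = cong (1 *_) (trans (sym (rowSums V∈𝒜 i)) (trans (sumFin-cong full) (sumFin-ones k)))
  ... | no  _    = refl

  sumFin-fullOnes : sumFin fullOnes ≡ t * k
  sumFin-fullOnes = begin
    sumFin fullOnes                          ≡⟨ sumFin≡sum fullOnes ⟩
    sum fullOnes                             ≡⟨ sum-cong-≗ (λ b → sumFin≡sum (λ i → [full] i * W i b)) ⟩
    sum (λ b → sum (λ i → [full] i * W i b)) ≡⟨ ∑-comm (λ i b → [full] i * W i b) ⟨
    sum (λ i → sum (λ b → [full] i * W i b)) ≡⟨ sum-cong-≗ (λ i → *-distribˡ-sum ([full] i) (W i)) ⟨
    sum (λ i → [full] i * sum (W i))         ≡⟨ sum-cong-≗ (λ i → cong ([full] i *_) (row-sum i)) ⟩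
    sum (λ i → [full] i * r i)               ≡⟨ sum-cong-≗ [full]*r≡[full]*k ⟩
    sum (λ i → [full] i * k)                 ≡⟨ *-distribʳ-sum k [full] ⟨
    sum [full] * k                           ≡⟨ cong (_* k) (sumFin≡sum [full]) ⟨
    t * k                                    ∎
    where
    open ≡-Reasoning
    row-sum : ∀ i → sum (W i) ≡ r i
    row-sum i = trans (sym (sumFin≡sum (W i))) (rowSums W∈𝒜 i)

  fullOnes≤t : ∀ b → fullOnes b ≤ t
  fullOnes≤t b = sumFin-mono λ i → subst ([full] i * W i b ≤_) (*-identityʳ ([full] i))
    (*-monoʳ-≤ ([full] i) (binary⇒≤1 (binary W∈𝒜 i b)))

  unit-column-meets-full-row : ∀ {b} → n b ≡ 1 → ∀ {j} → W j b ≡ 1 → Full j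
  unit-column-meets-full-row {b} nb≡1 {j} Wjb≡1 a =
    m*n≡1⇒m≡1 (V j a) (W j b) (trans (VW≗W j) Wjb≡1)
    where
    VW≗W : ∀ i → V i a * W i b ≡ W i b
    VW≗W = sumFin-≥⇒≗
      (λ i → subst (V i a * W i b ≤_) (*-identityˡ (W i b)) (*-monoˡ-≤ (W i b) (binary⇒≤1 (binary V∈𝒜 i a))))
      (subst (_≤ (V ᵀ· W) a b) (sym (trans (colSums W∈𝒜 b) nb≡1)) (prod-pos a b))

  fullOnes-unit : ∀ {b} → n b ≡ 1 → fullOnes b ≡ 1
  fullOnes-unit {b} nb≡1 = trans (sumFin-cong [full]*W≡W) (trans (colSums W∈𝒜 b) nb≡1)
    where
    [full]*W≡W : ∀ i → [full] i * W i b ≡ W i b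
    [full]*W≡W i with binary W∈𝒜 i b
    ... | inj₁ W≡0 rewrite W≡0 = *-zeroʳ ([full] i)
    ... | inj₂ W≡1 with full? i
    ...   | yes _    = +-identityʳ (W i b)
    ...   | no ¬full = ⊥-elim (¬full (unit-column-meets-full-row nb≡1 W≡1))

  ι≤t*k : ι n ≤ t * k
  ι≤t*k = subst (ι n ≤_) sumFin-fullOnes (ι≤sumFin n fullOnes (λ _ → fullOnes-unit))

  t*k+ι*t≤ι+ℓ*t : t * k + ι n * t ≤ ι n + ℓ * t
  t*k+ι*t≤ι+ℓ*t = subst (λ x → x + ι n * t ≤ ι n + ℓ * t) sumFin-fullOnes
    (sumFin+ι*t≤ι+ℓ*t n fullOnes t (λ _ → fullOnes-unit) fullOnes≤t)

floor*↧≤↥ : ∀ p → floor p ℤ.* ↧ p ℤ.≤ ↥ p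
floor*↧≤↥ p@record{} = [n/d]*d≤n (↥ p) (↧ p)

ceiling≡-⌊-p⌋ : ∀ p → ceiling p ≡ ℤ.- floor (ℚ.- p)
ceiling≡-⌊-p⌋ record{} = refl

i≤⌈i/n⌉*n : ∀ i n .{{_ : NonZero n}} → i ℤ.≤ ceiling (i ℚ./ n) ℤ.* + n
i≤⌈i/n⌉*n i n = begin
  i                                  ≡⟨ ℤ.neg-involutive i ⟨
  ℤ.- (ℤ.- i)                          ≡⟨ cong (λ j → ℤ.- (ℤ.- j)) (ℚ.↥-/ i n) ⟨
  ℤ.- (ℤ.- (↥ q ℤ.* g))                 ≡⟨ cong ℤ.-_ (ℤ.neg-distribˡ-* (↥ q) g) ⟩
  ℤ.- (ℤ.- ↥ q ℤ.* g)                   ≤⟨ ℤ.neg-mono-≤ floor-bound ⟩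
  ℤ.- (⌊-q⌋ ℤ.* ↧ q ℤ.* g)              ≡⟨ cong ℤ.-_ (ℤ.*-assoc ⌊-q⌋ (↧ q) g) ⟩
  ℤ.- (⌊-q⌋ ℤ.* (↧ q ℤ.* g))            ≡⟨ cong (λ j → ℤ.- (⌊-q⌋ ℤ.* j)) (ℚ.↧-/ i n) ⟩
  ℤ.- (⌊-q⌋ ℤ.* + n)                    ≡⟨ ℤ.neg-distribˡ-* ⌊-q⌋ (+ n) ⟩
  ℤ.- ⌊-q⌋ ℤ.* + n                      ≡⟨ cong (ℤ._* + n) (ceiling≡-⌊-p⌋ q) ⟨
  ceiling q ℤ.* + n                  ∎
  where
  open ℤ.≤-Reasoning
  q = i ℚ./ n
  g = gcd i (+ n)
  ⌊-q⌋ = floor (ℚ.- q)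
  floor-bound : ⌊-q⌋ ℤ.* ↧ q ℤ.* g ℤ.≤ ℤ.- ↥ q ℤ.* g
  floor-bound = ℤ.*-monoʳ-≤-nonNeg g
    (subst₂ (λ d e → ⌊-q⌋ ℤ.* d ℤ.≤ e) (ℚ.↧-neg q) (ℚ.↥-neg q) (floor*↧≤↥ (ℚ.- q)))

i≤+∣i∣ : ∀ i → i ℤ.≤ + ℤ.∣ i ∣
i≤+∣i∣ (+ n)    = ℤ.≤-refl
i≤+∣i∣ -[1+ n ] = -≤+

ℓ≤ψ*k : ∀ k ℓ .{{_ : NonZero k}} → ℓ ≤ ψ k ℓ * k
ℓ≤ψ*k k ℓ = ℤ.drop‿+≤+ (begin
  + ℓ                            ≤⟨ i≤⌈i/n⌉*n (+ ℓ) k ⟩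
  ceiling (+ ℓ ℚ./ k) ℤ.* + k    ≤⟨ ℤ.*-monoʳ-≤-nonNeg (+ k) (i≤+∣i∣ (ceiling (+ ℓ ℚ./ k))) ⟩
  + ψ k ℓ ℤ.* + k                ≡⟨ ℤ.pos-* (ψ k ℓ) k ⟨
  + (ψ k ℓ * k)                  ∎)
  where open ℤ.≤-Reasoning

ψ≥2 : ∀ k ℓ .{{_ : NonZero k}} → k < ℓ → 2 ≤ ψ k ℓ
ψ≥2 k ℓ k<ℓ = *-cancelʳ-< k 1 (ψ k ℓ)
  (subst (_< ψ k ℓ * k) (sym (*-identityˡ k)) (<-≤-trans k<ℓ (ℓ≤ψ*k k ℓ)))

cross-multiply-≤ : ∀ a b c d → a * suc d ≤ b * suc c → + a ℚ./ suc c ℚ.≤ + b ℚ./ suc d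
cross-multiply-≤ a b c d ad≤bc = ℚ.toℚᵘ-cancel-≤
  (ℚᵘ.≤-respʳ-≃ (ℚᵘ.≃-sym (ℚ.toℚᵘ-fromℚᵘ (mkℚᵘ (+ b) d)))
  (ℚᵘ.≤-respˡ-≃ (ℚᵘ.≃-sym (ℚ.toℚᵘ-fromℚᵘ (mkℚᵘ (+ a) c)))
  (*≤* (subst₂ ℤ._≤_ (ℤ.pos-* a (suc d)) (ℤ.pos-* b (suc c)) (ℤ.+≤+ ad≤bc)))))

cancel-common-part : ∀ {u s k d} → suc s * k + u * suc s ≤ u + (k + d) * suc s → u * s ≤ d * suc s
cancel-common-part {u} {s} {k} {d} h = +-cancelˡ-≤ (suc s * k + u) (u * s) (d * suc s) (begin
  suc s * k + u + u * s     ≡⟨ solve (u ∷ s ∷ k ∷ []) ⟩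
  suc s * k + u * suc s     ≤⟨ h ⟩
  u + (k + d) * suc s       ≡⟨ solve (u ∷ s ∷ k ∷ d ∷ []) ⟩
  suc s * k + u + d * suc s ∎)
  where open ≤-Reasoning

x/[x-1]-antitone : ∀ p s u d → suc p ≤ s → u * s ≤ d * suc s → u * suc p ≤ suc (suc p) * d
x/[x-1]-antitone p s@(suc s-1) u d p<s us≤d[s+1] = *-cancelˡ-≤ s (begin
  s * (u * suc p)         ≡⟨ solve (p ∷ s-1 ∷ u ∷ []) ⟩
  suc p * (u * s)         ≤⟨ *-monoʳ-≤ (suc p) us≤d[s+1] ⟩
  suc p * (d * suc s)     ≡⟨ solve (p ∷ s-1 ∷ d ∷ []) ⟩
  d * (suc p * s + suc p) ≤⟨ *-monoʳ-≤ d (+-monoʳ-≤ (suc p * s) p<s) ⟩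
  d * (suc p * s + s)     ≡⟨ solve (p ∷ s-1 ∷ d ∷ []) ⟩
  s * (suc (suc p) * d)   ∎)
  where open ≤-Reasoning

large-ι-bound : ∀ p {u t k d} → suc p * k < u → u ≤ t * k → t * k + u * t ≤ u + (k + d) * t →
                u * suc p ≤ suc (suc p) * d
large-ι-bound p {t = zero}  pk<u u≤0 _ = contradiction (<-≤-trans pk<u u≤0) n≮0
large-ι-bound p {u} {suc s} {k} {d} pk<u u≤tk main = x/[x-1]-antitone p s u d
  (≤-pred (*-cancelʳ-< k (suc p) (suc s) (<-≤-trans pk<u u≤tk))) (cancel-common-part {u} {s} {k} {d} main)

ιmax-shape-bound : ∀ P {u t k ℓ} → 2 ≤ P → k < ℓ → u ≤ t * k → t * k + u * t ≤ u + ℓ * t →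
  + u ℚ./ 1 ℚ.≤ (+ ((P ∸ 1) * k) ℚ./ 1) ⊔ (+ (P * (ℓ ∸ k)) ℚ./ suc (P ∸ 2))
ιmax-shape-bound (suc zero) (s≤s ())
ιmax-shape-bound (suc (suc p)) {u} {t} {k} {ℓ} _ k<ℓ u≤tk main with u ≤? suc p * k
... | yes u≤[P-1]k = ℚ.p≤q⇒p≤q⊔r _ (cross-multiply-≤ u (suc p * k) 0 0 (*-monoˡ-≤ 1 u≤[P-1]k))
... | no  u≰[P-1]k = ℚ.p≤q⇒p≤r⊔q (+ (suc p * k) ℚ./ 1) (cross-multiply-≤ u (suc (suc p) * d) 0 p
  (≤-trans (large-ι-bound p (≰⇒> u≰[P-1]k) u≤tk (subst (λ x → t * k + u * t ≤ u + x * t) ℓ≡k+d main))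
           (≤-reflexive (sym (*-identityʳ _)))))
  where
  d = ℓ ∸ k
  ℓ≡k+d : ℓ ≡ k + d
  ℓ≡k+d = sym (m+[n∸m]≡n (<⇒≤ k<ℓ))

proposition2p8 : (k ℓ : ℕ) → .{{_ : NonZero k}} → k < ℓ → (m : Fin k → ℕ) → (n : Fin ℓ → ℕ) → In𝒟̃ k ℓ m n → ((+ ι n) ℚ./ 1) ℚ.≤ ιmax k ℓ
proposition2p8 k ℓ k<ℓ m n D = ιmax-shape-bound (ψ k ℓ) (ψ≥2 k ℓ k<ℓ) k<ℓ ι≤t*k t*k+ι*t≤ι+ℓ*t
  where open FullRows D
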